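{- Let $c\in\{\text{red},\text{blue}\}$ and consider a coloring $\phi\colon E(K_5)\to\{\text{red},\text{blue}\}$. If there are exactly three edges with color $c$ and they form a triangle, then $w(\phi)=45$.
   Context: For a coloring $\psi\colon E(K_m)\to\{\text{red},\text{green},\text{blue}\}$ with no rainbow triangle (triangle with three distinct edge colors), regard $K_{m+1}$ as $K_m$ plus a new vertex $u$; $w(\psi)$ is the number of colorings of the edges from $u$ to $V(K_m)$ with colors in $\{\text{red},\text{green},\text{blue}\}$ such that the resulting coloring of $E(K_{m+1})$ has no rainbow triangle. -}

module Defs where

open import Data.Nat using (ℕ; zero; suc)
open import Data.Fin using (Fin; zero; suc)
open import Data.Fin.Properties using (all?; _≟_)
open import Data.List using (List; []; _∷_; map; concatMap; filter; length)
open import Data.Product using (_×_)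
open import Relation.Nullary using (¬_; Dec; yes; no; ¬?)
open import Relation.Nullary.Decidable using (_×-dec_; _→-dec_)
open import Relation.Binary.PropositionalEquality using (_≡_; _≢_; refl)
open import Relation.Binary using (DecidableEquality)
open import Relation.Unary using (Decidable)

data Colour : Set where
  red green blue : Colour

_≟c_ : DecidableEquality Colour
red   ≟c red   = yes refl
red   ≟c green = no λ ()
red   ≟c blue  = no λ ()
green ≟c red   = no λ ()
green ≟c green = yes refl
green ≟c blue  = no λ ()
blue  ≟c red   = no λ ()
blue  ≟c green = no λ ()
blue  ≟c blue  = yes refl

-- An edge colouring of K_m is given as a function on ordered pairs of
-- vertices; only its values on pairs of distinct vertices matter, and the
-- statements below require it to be symmetric.
Colouring : ℕ → Set
Colouring m = Fin m → Fin m → Colour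

Symmetric : ∀ {m} → Colouring m → Set
Symmetric {m} ψ = (i j : Fin m) → ψ i j ≡ ψ j i

Rainbow : Colour → Colour → Colour → Set
Rainbow x y z = x ≢ y × y ≢ z × x ≢ z

rainbow? : (x y z : Colour) → Dec (Rainbow x y z)
rainbow? x y z = ¬? (x ≟c y) ×-dec (¬? (y ≟c z) ×-dec ¬? (x ≟c z))

NoRainbowTriangle : ∀ {m} → Colouring m → Set
NoRainbowTriangle {m} ψ =
  (i j k : Fin m) → i ≢ j → j ≢ k → i ≢ k → ¬ Rainbow (ψ i j) (ψ j k) (ψ i k)

noRainbowTriangle? : ∀ {m} (ψ : Colouring m) → Dec (NoRainbowTriangle ψ)
noRainbowTriangle? ψ =
  all? λ i → all? λ j → all? λ k →
    ¬? (i ≟ j) →-dec (¬? (j ≟ k) →-dec (¬? (i ≟ k) →-dec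
      ¬? (rainbow? (ψ i j) (ψ j k) (ψ i k))))

-- K_{m+1} = K_m plus a new vertex u; here u is vertex 'zero' of Fin (suc m)
-- and the old vertex i is 'suc i'.  f gives the colours of the edges u–i.
extend : ∀ {m} → Colouring m → (Fin m → Colour) → Colouring (suc m)
extend ψ f zero    zero    = red   -- diagonal, irrelevant
extend ψ f zero    (suc j) = f j
extend ψ f (suc i) zero    = f i
extend ψ f (suc i) (suc j) = ψ i j

allColourFns : (m : ℕ) → List (Fin m → Colour)
allColourFns zero = (λ ()) ∷ []
allColourFns (suc m) =
  concatMap (λ c → map (λ f → λ { zero → c ; (suc i) → f i }) (allColourFns m))
            (red ∷ green ∷ blue ∷ [])

w : ∀ {m} → Colouring m → ℕ
w {m} ψ = length (filter (λ f → noRainbowTriangle? (extend ψ f)) (allColourFns m))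

-- Only the off-diagonal values of φ enter w, and the hypotheses pin these down completely:
-- c on the three edges of the triangle a b d, the other non-green colour elsewhere.  So
-- w φ = w of an explicit "triangle colouring", and for each of the finitely many triangles
-- in K₅ that number is computed by evaluating w.
module Submission where

open import Defs
open import Data.Fin using (Fin; zero; suc)
open import Data.Fin.Properties using (all?) renaming (_≟_ to _≟ᶠ_)
open import Data.Nat using () renaming (_≟_ to _≟ⁿ_)
open import Data.List using (length)
open import Data.List.Properties using (filter-≐)
open import Data.Product using (Σ; _×_; _,_)
open import Data.Sum using (_⊎_)
open import Data.Empty using (⊥-elim)
open import Relation.Nullary using (Dec; yes; no; ¬?)
open import Relation.Nullary.Decidable using (_×-dec_; _⊎-dec_; _→-dec_; from-yes)
open import Relation.Binary.PropositionalEquality using (_≡_; _≢_; refl; sym; cong; module ≡-Reasoning)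
open import Function.Bundles using (_⇔_; Equivalence)

AgreeOffDiagonal : ∀ {m} → Colouring m → Colouring m → Set
AgreeOffDiagonal {m} φ ψ = (i j : Fin m) → i ≢ j → φ i j ≡ ψ i j

extend-agree : ∀ {m} {φ ψ : Colouring m} → AgreeOffDiagonal φ ψ →
  (f : Fin m → Colour) → AgreeOffDiagonal (extend φ f) (extend ψ f)
extend-agree φ≈ψ f zero    zero    i≢j = ⊥-elim (i≢j refl)
extend-agree φ≈ψ f zero    (suc j) i≢j = refl
extend-agree φ≈ψ f (suc i) zero    i≢j = refl
extend-agree φ≈ψ f (suc i) (suc j) i≢j = φ≈ψ i j (λ i≡j → i≢j (cong suc i≡j))

noRainbowTriangle-resp : ∀ {m} {φ ψ : Colouring m} → AgreeOffDiagonal φ ψ →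
  NoRainbowTriangle φ → NoRainbowTriangle ψ
noRainbowTriangle-resp φ≈ψ noRainbow i j k i≢j j≢k i≢k
  rewrite sym (φ≈ψ i j i≢j) | sym (φ≈ψ j k j≢k) | sym (φ≈ψ i k i≢k) =
  noRainbow i j k i≢j j≢k i≢k

agree-sym : ∀ {m} {φ ψ : Colouring m} → AgreeOffDiagonal φ ψ → AgreeOffDiagonal ψ φ
agree-sym φ≈ψ i j i≢j = sym (φ≈ψ i j i≢j)

w-resp : ∀ {m} {φ ψ : Colouring m} → AgreeOffDiagonal φ ψ → w φ ≡ w ψ
w-resp {m} φ≈ψ = cong length (filter-≐ _ _ (forth , back) (allColourFns m))
  where
  forth = λ {f} → noRainbowTriangle-resp (extend-agree φ≈ψ f)
  back  = λ {f} → noRainbowTriangle-resp (extend-agree (agree-sym φ≈ψ) f)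

opposite : Colour → Colour
opposite red   = blue
opposite green = green
opposite blue  = red

≢green-≢⇒opposite : ∀ {c x} → c ≢ green → x ≢ green → x ≢ c → x ≡ opposite c
≢green-≢⇒opposite {red}   {red}   c≢g x≢g x≢c = ⊥-elim (x≢c refl)
≢green-≢⇒opposite {red}   {green} c≢g x≢g x≢c = ⊥-elim (x≢g refl)
≢green-≢⇒opposite {red}   {blue}  c≢g x≢g x≢c = refl
≢green-≢⇒opposite {green} {x}     c≢g x≢g x≢c = ⊥-elim (c≢g refl)
≢green-≢⇒opposite {blue}  {red}   c≢g x≢g x≢c = refl
≢green-≢⇒opposite {blue}  {green} c≢g x≢g x≢c = ⊥-elim (x≢g refl)
≢green-≢⇒opposite {blue}  {blue}  c≢g x≢g x≢c = ⊥-elim (x≢c refl)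

TriangleEdge : ∀ {m} → Fin m → Fin m → Fin m → Fin m → Fin m → Set
TriangleEdge a b d i j = (i ≡ a × j ≡ b) ⊎ ((i ≡ b × j ≡ a) ⊎ ((i ≡ a × j ≡ d) ⊎
  ((i ≡ d × j ≡ a) ⊎ ((i ≡ b × j ≡ d) ⊎ (i ≡ d × j ≡ b)))))

triangleEdge? : ∀ {m} (a b d i j : Fin m) → Dec (TriangleEdge a b d i j)
triangleEdge? a b d i j =
  (i ≟ᶠ a ×-dec j ≟ᶠ b) ⊎-dec ((i ≟ᶠ b ×-dec j ≟ᶠ a) ⊎-dec ((i ≟ᶠ a ×-dec j ≟ᶠ d) ⊎-dec
  ((i ≟ᶠ d ×-dec j ≟ᶠ a) ⊎-dec ((i ≟ᶠ b ×-dec j ≟ᶠ d) ⊎-dec (i ≟ᶠ d ×-dec j ≟ᶠ b)))))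

triangleColouring : ∀ {m} → Colour → Fin m → Fin m → Fin m → Colouring m
triangleColouring c a b d i j with triangleEdge? a b d i j
... | yes _ = c
... | no  _ = opposite c

agree-triangleColouring : ∀ {m} {c} (φ : Colouring m) (a b d : Fin m) → c ≢ green →
  ((i j : Fin m) → i ≢ j → φ i j ≢ green) →
  ((i j : Fin m) → i ≢ j → (φ i j ≡ c ⇔ TriangleEdge a b d i j)) →
  AgreeOffDiagonal φ (triangleColouring c a b d)
agree-triangleColouring φ a b d c≢g φ≢g φ≡c⇔edge i j i≢j with triangleEdge? a b d i j
... | yes edge = Equivalence.from (φ≡c⇔edge i j i≢j) edge
... | no ¬edge = ≢green-≢⇒opposite c≢g (φ≢g i j i≢j)
                   (λ φ≡c → ¬edge (Equivalence.to (φ≡c⇔edge i j i≢j) φ≡c))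

W-TriangleColouring : Colour → Set
W-TriangleColouring c = (a b d : Fin 5) → a ≢ b → b ≢ d → a ≢ d →
  w (triangleColouring c a b d) ≡ 45

w-triangleColouring? : ∀ c → Dec (W-TriangleColouring c)
w-triangleColouring? c = all? λ a → all? λ b → all? λ d →
  ¬? (a ≟ᶠ b) →-dec (¬? (b ≟ᶠ d) →-dec (¬? (a ≟ᶠ d) →-dec
    (w (triangleColouring c a b d) ≟ⁿ 45)))

w-triangleColouring : ∀ {c} → c ≢ green → W-TriangleColouring c
w-triangleColouring {red}   _   = from-yes (w-triangleColouring? red)
w-triangleColouring {green} c≢g = ⊥-elim (c≢g refl)
w-triangleColouring {blue}  _   = from-yes (w-triangleColouring? blue)

lemma4p3 : (c : Colour) → c ≢ green →
    (φ : Colouring 5) → Symmetric φ →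
    ((i j : Fin 5) → i ≢ j → φ i j ≢ green) →
    (Σ (Fin 5) λ a → Σ (Fin 5) λ b → Σ (Fin 5) λ d →
      a ≢ b × b ≢ d × a ≢ d ×
      ((i j : Fin 5) → i ≢ j →
        (φ i j ≡ c ⇔ ((i ≡ a × j ≡ b) ⊎ ((i ≡ b × j ≡ a) ⊎ ((i ≡ a × j ≡ d) ⊎
          ((i ≡ d × j ≡ a) ⊎ ((i ≡ b × j ≡ d) ⊎ (i ≡ d × j ≡ b))))))))) →
    w φ ≡ 45
lemma4p3 c c≢g φ _ φ≢g (a , b , d , a≢b , b≢d , a≢d , φ≡c⇔edge) = begin
  w φ                           ≡⟨ w-resp (agree-triangleColouring φ a b d c≢g φ≢g φ≡c⇔edge) ⟩
  w (triangleColouring c a b d) ≡⟨ w-triangleColouring c≢g a b d a≢b b≢d a≢d ⟩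
  45                            ∎
  where open ≡-Reasoning
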